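{- Let $F=T[a\,..\,b]$ and $F'=T[a'\,..\,b']$ be neighboring runs of a string $T$ with $a<a'$, the same period $p$ and equal Lyndon roots. Let $\ell$ and $\ell'$ be the Lyndon positions of $F$ and $F'$, let $\delta=(\ell'-\ell)\bmod p$, and for $k\in\mathbb{Z}$ let $a'_k=a'-kp-\delta$ and $b_k=b+kp+\delta$. Then the set $\mathcal{R}=\{T[x\,..\,y]\in\mathbf{P}(F,F') : x,y\in(a\,..\,b')\}$ is equal to $\mathcal{K}=\{T[a'_k\,..\,b_k] : k\in K\}$, where $K=\{k\in\mathbb{Z} : k\ge 4,\ a'_k>a,\ b_k<b'\}$. Moreover, for each $k\in K$, the period of the run $T[a'_k\,..\,b_k]$ is $kp+\delta$.
   Context: Strings are 0-indexed; $T[i\,..\,j]$ is a fragment; $(a\,..\,b')=\{a+1,\dots,b'-1\}$. A positive integer $r\le |S|$ is a period of $S$ if $S[i]=S[i+r]$ for all valid $i$; $\mathrm{per}(S)$ is the smallest period; $S$ is periodic if $\mathrm{per}(S)\le|S|/2$. A run of $T$ is a periodic fragment $T[a\,..\,b]$ with $r=\mathrm{per}(T[a\,..\,b])$ such that ($a=0$ or $T[a-1]\ne T[a-1+r]$) and ($b=|T|-1$ or $T[b+1]\ne T[b+1-r]$). The Lyndon root $\lambda$ of a periodic string $S$ is the lexicographically smallest rotation of $S[0\,..\,\mathrm{per}(S))$; the Lyndon position of a run $R=T[a\,..\,b]$ with Lyndon root $\lambda$ is the unique $i\in[a\,..\,a+\mathrm{per}(R))$ with $T[i\,..\,i+\mathrm{per}(R))=\lambda$.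 Fragments $T[a\,..\,b]$, $T[a'\,..\,b']$ are neighboring if $[a-1\,..\,b+1]\cap[a'\,..\,b']\ne\emptyset$; then $F\cup F'=T[\min(a,a')\,..\,\max(b,b')]$ and $F\cap F'=T[\max(a,a')\,..\,\min(b,b')]$. A square $X^2$ is generated by a periodic fragment $U$ if $X^2$ is a fragment contained in $U$ with $\mathrm{per}(X^2)=\mathrm{per}(U)$; $\mathrm{frag\text{ - }squares}(U)$ is the set of these. $\mathrm{subper}(U)=\min\{\mathrm{per}(X):X^2\in\mathrm{frag\text{ - }squares}(U)\}$; $U$ is subperiodic if $\mathrm{subper}(U)\le\mathrm{per}(U)/4$. The pyramid $\mathbf{P}(F,F')$ is the set of subperiodic runs $R$ of $T$ with $\mathrm{subper}(R)=p$ such that $R\cap(F\cup F')$ is periodic with period $\mathrm{per}(R)$. -}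

module Defs where

open import Data.Nat using (ℕ; zero; suc; _+_; _*_; _∸_; _≤_; _<_; _<ᵇ_; _⊔_; _⊓_; NonZero)
open import Data.Bool using (if_then_else_)
open import Data.Product using (Σ; _×_; ∃; ∃-syntax)
open import Data.Sum using (_⊎_)
open import Relation.Binary.PropositionalEquality using (_≡_; _≢_)
open import Data.Integer as ℤ using (ℤ; +_)
open import Data.Integer.Base using (_%ℕ_)

-- A string T of length n over the ordered alphabet ℕ is a function
-- T : ℕ → ℕ of which only the positions 0 .. n-1 are relevant.
-- A fragment T[x..y] is represented by its endpoints (x , y).

Fragment : ℕ → ℕ → ℕ → Set
Fragment n x y = x ≤ y × y < n

len : ℕ → ℕ → ℕ
len x y = suc y ∸ x

HasPeriod : (ℕ → ℕ) → ℕ → ℕ → ℕ → Set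
HasPeriod T x y r =
  1 ≤ r × r ≤ len x y × (∀ i → x ≤ i → i + r ≤ y → T i ≡ T (i + r))

IsPer : (ℕ → ℕ) → ℕ → ℕ → ℕ → Set
IsPer T x y r = HasPeriod T x y r × (∀ r' → HasPeriod T x y r' → r ≤ r')

Periodic : (ℕ → ℕ) → ℕ → ℕ → Set
Periodic T x y = Σ ℕ λ r → IsPer T x y r × 2 * r ≤ len x y

IsRun : ℕ → (ℕ → ℕ) → ℕ → ℕ → ℕ → Set
IsRun n T x y r =
  Fragment n x y × IsPer T x y r × 2 * r ≤ len x y
  × (x ≡ 0 ⊎ T (x ∸ 1) ≢ T (x ∸ 1 + r))
  × (suc y ≡ n ⊎ T (suc y) ≢ T (suc y ∸ r))

LexLe : ℕ → (ℕ → ℕ) → (ℕ → ℕ) → Set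
LexLe r u v =
  (∀ k → k < r → u k ≡ v k)
  ⊎ (Σ ℕ λ k → k < r × (∀ j → j < k → u j ≡ v j) × u k < v k)

rot : ℕ → (ℕ → ℕ) → ℕ → (ℕ → ℕ)
rot r s j k = if (j + k) <ᵇ r then s (j + k) else s (j + k ∸ r)

IsLyndonRoot : (ℕ → ℕ) → ℕ → ℕ → (ℕ → ℕ) → Set
IsLyndonRoot T x r lam =
  (Σ ℕ λ j → j < r × (∀ k → k < r → lam k ≡ rot r (λ i → T (x + i)) j k))
  × (∀ j → j < r → LexLe r lam (rot r (λ i → T (x + i)) j))

IsLyndonPos : (ℕ → ℕ) → ℕ → ℕ → (ℕ → ℕ) → ℕ → Set
IsLyndonPos T x r lam ℓ =
  x ≤ ℓ × ℓ < x + r × (∀ k → k < r → T (ℓ + k) ≡ lam k)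

GenSquare : (ℕ → ℕ) → ℕ → ℕ → ℕ → ℕ → ℕ → Set
GenSquare T x y r i m =
  1 ≤ m × x ≤ i × i + 2 * m ≤ suc y
  × (∀ j → j < m → T (i + j) ≡ T (i + m + j))
  × IsPer T i (i + 2 * m ∸ 1) r

IsSubper : (ℕ → ℕ) → ℕ → ℕ → ℕ → ℕ → Set
IsSubper T x y r s =
  (Σ ℕ λ i → Σ ℕ λ m → GenSquare T x y r i m × IsPer T i (i + m ∸ 1) s)
  × (∀ i m s' → GenSquare T x y r i m → IsPer T i (i + m ∸ 1) s' → s ≤ s')

-- R = T[x..y] ∈ P(F,F') where F ∪ F' = T[u..v] and p is the common period:
-- R is a subperiodic run with subper(R) = p and R ∩ (F ∪ F') is periodic
-- with per(R ∩ (F ∪ F')) = per(R)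
InPyramid : ℕ → (ℕ → ℕ) → ℕ → ℕ → ℕ → ℕ → ℕ → Set
InPyramid n T p u v x y =
  Σ ℕ λ r → IsRun n T x y r × IsSubper T x y r p × 4 * p ≤ r
    × Periodic T (x ⊔ u) (y ⊓ v) × IsPer T (x ⊔ u) (y ⊓ v) r

delta : ℕ → ℕ → (p : ℕ) → .{{NonZero p}} → ℕ
delta ℓ ℓ' p = (+ ℓ' ℤ.- + ℓ) %ℕ p

a'k : ℕ → ℕ → ℕ → ℤ → ℤ
a'k a' p δ k = + a' ℤ.- k ℤ.* + p ℤ.- + δ

bk : ℕ → ℕ → ℕ → ℤ → ℤ
bk b p δ k = + b ℤ.+ k ℤ.* + p ℤ.+ + δ

-- On a run of period p whose Lyndon position is ℓ, the letter at y is λ[(y - ℓ) mod p]. Since F' starts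
-- within the last period of F, a position i of F and a position i + cp + δ of F' carry the same letter,
-- so for k ≥ 4 the fragment T[a'_k .. b_k] has period kp + δ. A shorter period would, by Fine–Wilf
-- against F, make p divide δ, and an extension of this fragment would extend F or F'; the root of each
-- of its squares is at least 4p long, so contains a length-2p window of F or F', whence subperiod p.
-- Conversely, a pyramid run of period r ≥ 4p aligns a length-p block of F with one of F' at distance
-- r, so primitivity of λ forces r ≡ δ (mod p), and the maximality of the three runs fixes its ends at
-- a'_k and b_k.
module Submission where

open import Defs
open import Data.Nat
open import Data.Nat.Properties
open import Data.Nat.DivMod
open import Data.Nat.Divisibility
  using (_∣_; divides; ∣⇒≤; ∣m∣n⇒∣m+n; ∣-refl; ∣m+n∣m⇒∣n; ∣-trans; n∣m*n; n∣m⇒m%n≡0)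
open import Data.Nat.Tactic.RingSolver using (solve-∀)
open import Data.Product using (Σ; _×_; _,_; proj₁; proj₂)
open import Data.Sum using (_⊎_; inj₁; inj₂)
open import Data.Empty using (⊥-elim)
open import Relation.Nullary using (yes; no)
open import Relation.Binary using (tri<; tri≈; tri>)
open import Relation.Binary.PropositionalEquality
open import Data.Integer as ℤ using (ℤ; +_; -[1+_]; +≤+; +<+)
import Data.Integer.Properties as ℤ
import Data.Integer.Tactic.RingSolver as ℤ
open import Function.Bundles using (_⇔_; mk⇔)

2*≡+ : ∀ m → 2 * m ≡ m + m
2*≡+ m = cong (_+_ m) (+-identityʳ m)

4*≡ : ∀ m → 4 * m ≡ m + m + (m + m)
4*≡ = solve-∀

+-swapʳ : ∀ x j q → x + j + q ≡ x + q + j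
+-swapʳ = solve-∀

+-interchange : ∀ m n → m + n + (m + n) ≡ m + m + (n + n)
+-interchange = solve-∀

suc-∸1 : ∀ {m n} → m < n → suc (n ∸ 1) ≡ n
suc-∸1 {n = suc _} _ = refl

m+m≤n+n⇒m≤n : ∀ {m n} → m + m ≤ n + n → m ≤ n
m+m≤n+n⇒m≤n {m} {n} m+m≤n+n with m ≤? n
... | yes m≤n = m≤n
... | no m≰n = ⊥-elim (<⇒≱ (+-mono-< (≰⇒> m≰n) (≰⇒> m≰n)) m+m≤n+n)

proper-divisor-half : ∀ {g q} → g ∣ q → g < q → g + g ≤ q
proper-divisor-half (divides zero refl) ()
proper-divisor-half {g} (divides (suc zero) refl) g<q = ⊥-elim (<-irrefl (sym (+-identityʳ g)) g<q)
proper-divisor-half {g} (divides (suc (suc m)) refl) _ = +-monoʳ-≤ g (m≤m+n g (m * g))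

divisor≤ : ∀ {g r} → 1 ≤ r → g ∣ r → g ≤ r
divisor≤ {r = suc _} _ = ∣⇒≤

≤len : ∀ {x y r} → r + x ≤ suc y → r ≤ len x y
≤len {x} {y} {r} = m+n≤o⇒m≤o∸n r

len⇒≤ : ∀ {x y r} → 1 ≤ r → r ≤ len x y → r + x ≤ suc y
len⇒≤ {x} {y} {r} 1≤r r≤ with x ≤? suc y
... | yes x≤ = m≤o∸n⇒m+n≤o r x≤ r≤
... | no x≰ = ⊥-elim (<⇒≱ 1≤r (≤-trans r≤ (≤-reflexive (m≤n⇒m∸n≡0 (<⇒≤ (≰⇒> x≰))))))

square≤len : ∀ {x y r} → x + (r + r) ≤ suc y → 2 * r ≤ len x y
square≤len {x} {y} {r} h = ≤len (≤-trans (≤-reflexive (trans (cong (_+ x) (2*≡+ r)) (+-comm (r + r) x))) h)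

len⇒square≤ : ∀ {x y r} → 1 ≤ r → 2 * r ≤ len x y → x + (r + r) ≤ suc y
len⇒square≤ {x} {y} {r} 1≤r h =
  ≤-trans (≤-reflexive (trans (+-comm x (r + r)) (cong (_+ x) (sym (2*≡+ r)))))
          (len⇒≤ (≤-trans 1≤r (m≤m+n r (r + 0))) h)

run-isPer : ∀ {n T x y r} → IsRun n T x y r → IsPer T x y r
run-isPer run = proj₁ (proj₂ run)

run-square : ∀ {n T x y r} → IsRun n T x y r → 2 * r ≤ len x y
run-square run = proj₁ (proj₂ (proj₂ run))

run-left-maximal : ∀ {n T x y r} → IsRun n T x y r → x ≡ 0 ⊎ T (x ∸ 1) ≢ T (x ∸ 1 + r)
run-left-maximal run = proj₁ (proj₂ (proj₂ (proj₂ run)))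

run-right-maximal : ∀ {n T x y r} → IsRun n T x y r → suc y ≡ n ⊎ T (suc y) ≢ T (suc y ∸ r)
run-right-maximal run = proj₂ (proj₂ (proj₂ (proj₂ run)))

RepeatsWith : (ℕ → ℕ) → ℕ → ℕ → ℕ → Set
RepeatsWith T x y r = ∀ i → x ≤ i → i + r ≤ y → T i ≡ T (i + r)

repeatsWith-restrict : ∀ {T x y x' y' r} → RepeatsWith T x y r → x ≤ x' → y' ≤ y → RepeatsWith T x' y' r
repeatsWith-restrict h x≤x' y'≤y i x'≤i i+r≤y' = h i (≤-trans x≤x' x'≤i) (≤-trans i+r≤y' y'≤y)

repeatsWith-* : ∀ {T x y r} → RepeatsWith T x y r → ∀ c i → x ≤ i → i + c * r ≤ y → T i ≡ T (i + c * r)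
repeatsWith-* {T} h zero i _ _ = cong T (sym (+-identityʳ i))
repeatsWith-* {T} {x} {y} {r} h (suc c) i x≤i bound =
  trans (h i x≤i (≤-trans (+-monoʳ-≤ i (m≤m+n r (c * r))) bound))
  (trans (repeatsWith-* h c (i + r) (≤-trans x≤i (m≤m+n i r)) (≤-trans (≤-reflexive (+-assoc i r (c * r))) bound))
         (cong T (+-assoc i r (c * r))))

repeatsWith-difference : ∀ {T x y s d} → RepeatsWith T x y s → RepeatsWith T x y (s + d)
  → x + (s + (s + d)) ≤ suc y → RepeatsWith T x y d
repeatsWith-difference {T} {x} {y} {s} {d} hs hsd long i x≤i i+d≤y with x + s ≤? i
... | yes x+s≤i =
  trans (cong T (sym w+s≡i))
  (trans (sym (hs w x≤w (≤-trans (≤-reflexive w+s≡i) (≤-trans (m≤m+n i d) i+d≤y))))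
  (trans (hsd w x≤w (≤-trans (≤-reflexive w+sd≡i+d) i+d≤y)) (cong T w+sd≡i+d)))
  where
    w = i ∸ s
    w+s≡i : w + s ≡ i
    w+s≡i = m∸n+n≡m (≤-trans (m≤n+m s x) x+s≤i)
    x≤w : x ≤ w
    x≤w = m+n≤o⇒m≤o∸n x x+s≤i
    w+sd≡i+d : w + (s + d) ≡ i + d
    w+sd≡i+d = trans (sym (+-assoc w s d)) (cong (_+ d) w+s≡i)
... | no x+s≰i =
  trans (hsd i x≤i (≤-pred i+sd<y))
  (trans (cong T (reorder i s d))
  (sym (hs (i + d) (≤-trans x≤i (m≤m+n i d)) (≤-trans (≤-reflexive (sym (reorder i s d))) (≤-pred i+sd<y)))))
  where
    reorder : ∀ i s d → i + (s + d) ≡ i + d + s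
    reorder = solve-∀
    i+sd<y : suc (i + (s + d)) ≤ suc y
    i+sd<y = ≤-trans (+-monoˡ-≤ (s + d) (≰⇒> x+s≰i)) (≤-trans (≤-reflexive (+-assoc x s (s + d))) long)

-- Weak Fine–Wilf: run Euclid's subtractive algorithm on the two periods.
common-divisor-period : ∀ {T x y} s q → 1 ≤ s → 1 ≤ q → RepeatsWith T x y s → RepeatsWith T x y q
  → x + (s + q) ≤ suc y → Σ ℕ λ g → 1 ≤ g × g ∣ s × g ∣ q × RepeatsWith T x y g
common-divisor-period {T} {x} {y} s q = euclid (s + q) s q ≤-refl
  where
    positive-difference : ∀ {s d} → s < s + d → 1 ≤ d
    positive-difference {s} {zero} lt = ⊥-elim (<-irrefl (sym (+-identityʳ s)) lt)
    positive-difference {d = suc _} _ = s≤s z≤n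

    euclid : ∀ N s q → s + q ≤ N → 1 ≤ s → 1 ≤ q → RepeatsWith T x y s → RepeatsWith T x y q
      → x + (s + q) ≤ suc y → Σ ℕ λ g → 1 ≤ g × g ∣ s × g ∣ q × RepeatsWith T x y g
    euclid zero s q s+q≤0 1≤s _ _ _ _ = ⊥-elim (<⇒≱ (≤-trans 1≤s (m≤m+n s q)) s+q≤0)
    euclid (suc N) s q s+q≤N 1≤s 1≤q hs hq long with <-cmp s q
    ... | tri≈ _ refl _ = s , 1≤s , ∣-refl , ∣-refl , hq
    ... | tri< s<q _ _ with m≤n⇒∃[o]m+o≡n (<⇒≤ s<q)
    ...   | d , refl =
      let long' = ≤-trans (+-monoʳ-≤ x (+-monoʳ-≤ s (m≤n+m d s))) long
          (g , 1≤g , g∣s , g∣d , hg) =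
            euclid N s d (≤-pred (≤-trans (+-monoˡ-≤ (s + d) 1≤s) s+q≤N)) 1≤s (positive-difference s<q)
                   hs (repeatsWith-difference hs hq long) long'
      in g , 1≤g , g∣s , ∣m∣n⇒∣m+n g∣s g∣d , hg
    euclid (suc N) s q s+q≤N 1≤s 1≤q hs hq long | tri> _ _ q<s with m≤n⇒∃[o]m+o≡n (<⇒≤ q<s)
    ...   | d , refl =
      let long-swapped = ≤-trans (≤-reflexive (cong (_+_ x) (+-comm q (q + d)))) long
          long' = ≤-trans (+-monoʳ-≤ x (+-monoˡ-≤ q (m≤n+m d q))) long
          (g , 1≤g , g∣d , g∣q , hg) =
            euclid N d q (≤-pred (≤-trans (+-monoˡ-≤ (d + q) 1≤q) (≤-trans (≤-reflexive (sym (+-assoc q d q))) s+q≤N)))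
                   (positive-difference q<s) 1≤q (repeatsWith-difference hq hs long-swapped) hq long'
      in g , 1≤g , ∣m∣n⇒∣m+n g∣q g∣d , g∣q , hg

per∣period : ∀ {T x y r s} → IsPer T x y r → RepeatsWith T x y s → 1 ≤ s → x + (r + s) ≤ suc y → r ∣ s
per∣period {r = r} {s} ((1≤r , r≤len , hr) , minimal) hs 1≤s long =
  let (g , 1≤g , g∣r , g∣s , hg) = common-divisor-period r s 1≤r 1≤s hr hs long
      g≤r = divisor≤ 1≤r g∣r
  in subst (_∣ s) (≤-antisym g≤r (minimal g (1≤g , ≤-trans g≤r r≤len , hg))) g∣s

square-repeats : ∀ {T i m} → 1 ≤ m → (∀ j → j < m → T (i + j) ≡ T (i + m + j)) → RepeatsWith T i (i + 2 * m ∸ 1) m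
square-repeats {T} {i} {m} 1≤m agree i' i≤i' i'+m≤end =
  trans (cong T (sym i+j≡i')) (trans (agree j j<m) (cong T (trans (+-swapʳ i m j) (cong (_+ m) i+j≡i'))))
  where
    open ≤-Reasoning
    j = i' ∸ i
    i+j≡i' : i + j ≡ i'
    i+j≡i' = m+[n∸m]≡n i≤i'
    j<m : j < m
    j<m = +-cancelʳ-≤ m (suc j) m (+-cancelˡ-≤ i (suc j + m) (m + m) (begin
      i + (suc j + m)      ≡⟨ +-suc i (j + m) ⟩
      suc (i + (j + m))    ≡⟨ cong suc (trans (sym (+-assoc i j m)) (cong (_+ m) i+j≡i')) ⟩
      suc (i' + m)         ≤⟨ s≤s i'+m≤end ⟩
      suc (i + 2 * m ∸ 1)  ≡⟨ suc-∸1 (≤-trans 1≤m (≤-trans (m≤m+n m (m + 0)) (m≤n+m (2 * m) i))) ⟩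
      i + 2 * m            ≡⟨ cong (_+_ i) (2*≡+ m) ⟩
      i + (m + m)          ∎))

square-half≤len : ∀ {i m} → 1 ≤ m → m ≤ len i (i + 2 * m ∸ 1)
square-half≤len {i} {m} 1≤m = ≤len (begin
  m + i                ≤⟨ +-monoˡ-≤ i (m≤m+n m (m + 0)) ⟩
  2 * m + i            ≡⟨ +-comm (2 * m) i ⟩
  i + 2 * m            ≡⟨ suc-∸1 (≤-trans 1≤m (≤-trans (m≤m+n m (m + 0)) (m≤n+m (2 * m) i))) ⟨
  suc (i + 2 * m ∸ 1)  ∎)
  where open ≤-Reasoning

[m%n+k]%n≡[m+k]%n : ∀ m k n .{{_ : NonZero n}} → (m % n + k) % n ≡ (m + k) % n
[m%n+k]%n≡[m+k]%n m k n = begin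
  (m % n + k) % n          ≡⟨ %-distribˡ-+ (m % n) k n ⟩
  (m % n % n + k % n) % n  ≡⟨ cong (λ u → (u + k % n) % n) (m%n%n≡m%n m n) ⟩
  (m % n + k % n) % n      ≡⟨ %-distribˡ-+ m k n ⟨
  (m + k) % n              ∎
  where open ≡-Reasoning

%-congˡ-+ : ∀ {m m'} k n .{{_ : NonZero n}} → m % n ≡ m' % n → (m + k) % n ≡ (m' + k) % n
%-congˡ-+ {m} {m'} k n eq = begin
  (m + k) % n      ≡⟨ [m%n+k]%n≡[m+k]%n m k n ⟨
  (m % n + k) % n  ≡⟨ cong (λ u → (u + k) % n) eq ⟩
  (m' % n + k) % n ≡⟨ [m%n+k]%n≡[m+k]%n m' k n ⟩
  (m' + k) % n     ∎
  where open ≡-Reasoning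

-- Adding (n - 1) c turns c + u into u + c n.
+-cancelˡ-% : ∀ c u w n .{{_ : NonZero n}} → (c + u) % n ≡ (c + w) % n → u % n ≡ w % n
+-cancelˡ-% c u w n@(suc n₀) eq = begin
  u % n                      ≡⟨ [m+kn]%n≡m%n u c n ⟨
  (u + c * n) % n            ≡⟨ cong (_% n) (shift u) ⟩
  (c + u + n₀ * c) % n       ≡⟨ %-congˡ-+ {c + u} {c + w} (n₀ * c) n eq ⟩
  (c + w + n₀ * c) % n       ≡⟨ cong (_% n) (shift w) ⟨
  (w + c * n) % n            ≡⟨ [m+kn]%n≡m%n w c n ⟩
  w % n                      ∎
  where
    open ≡-Reasoning
    identity : ∀ v c n₀ → v + c * suc n₀ ≡ c + v + n₀ * c
    identity = solve-∀
    shift : ∀ v → v + c * n ≡ c + v + n₀ * c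
    shift v = identity v c n₀

∃-offset-% : ∀ w z n .{{_ : NonZero n}} → Σ ℕ λ t → t < n × (w + t) % n ≡ z % n
∃-offset-% w z n@(suc n₀) = t , m%n<n (z + n₀ * w) n , (begin
  (w + t) % n               ≡⟨ cong (_% n) (+-comm w t) ⟩
  (t + w) % n               ≡⟨ [m%n+k]%n≡[m+k]%n (z + n₀ * w) w n ⟩
  (z + n₀ * w + w) % n      ≡⟨ cong (_% n) (absorb z w n₀) ⟩
  (z + w * n) % n           ≡⟨ [m+kn]%n≡m%n z w n ⟩
  z % n                     ∎)
  where
    open ≡-Reasoning
    t = (z + n₀ * w) % n
    absorb : ∀ z w n₀ → z + n₀ * w + w ≡ z + w * suc n₀
    absorb = solve-∀

module Phase (T : ℕ → ℕ) (p₀ a b : ℕ) (lam : ℕ → ℕ) (ℓ : ℕ)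
  (isPer : IsPer T a b (suc p₀)) (long : a + (suc p₀ + suc p₀) ≤ suc b)
  (lyndon : IsLyndonPos T a (suc p₀) lam ℓ) where

  P : ℕ
  P = suc p₀

  private
    repeats : RepeatsWith T a b P
    repeats = proj₂ (proj₂ (proj₁ isPer))
    a≤ℓ = proj₁ lyndon
    ℓ<a+P = proj₁ (proj₂ lyndon)
    T≡lam = proj₂ (proj₂ lyndon)

  -- p₀ ℓ ≡ - ℓ (mod P): the phase of y is its offset from the Lyndon position, modulo P.
  phase : ℕ → ℕ
  phase y = (y + p₀ * ℓ) % P

  ℓ+P≤b : ℓ + P ≤ b
  ℓ+P≤b = ≤-pred (≤-trans (+-monoˡ-≤ P ℓ<a+P) (≤-trans (≤-reflexive (+-assoc a P P)) long))

  T-from-ℓ : ∀ c t → t < P → ℓ + t + c * P ≤ b → T (ℓ + t + c * P) ≡ lam t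
  T-from-ℓ zero t t<P _ = trans (cong T (+-identityʳ (ℓ + t))) (T≡lam t t<P)
  T-from-ℓ (suc c) t t<P bound =
    trans (cong T (sym next)) (trans (sym (repeats i a≤i (≤-trans (≤-reflexive next) bound)))
          (T-from-ℓ c t t<P (≤-trans (m≤m+n i P) (≤-trans (≤-reflexive next) bound))))
    where
      i = ℓ + t + c * P
      a≤i = ≤-trans a≤ℓ (≤-trans (m≤m+n ℓ t) (m≤m+n (ℓ + t) (c * P)))
      identity : ∀ l t c p₀ → l + t + c * suc p₀ + suc p₀ ≡ l + t + suc c * suc p₀
      identity = solve-∀
      next : i + P ≡ ℓ + t + suc c * P
      next = identity ℓ t c p₀

  T≡lam∘phase-from-ℓ : ∀ y → ℓ ≤ y → y ≤ b → T y ≡ lam (phase y)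
  T≡lam∘phase-from-ℓ y ℓ≤y y≤b =
    trans (cong T y≡) (trans (T-from-ℓ (m / P) (m % P) (m%n<n m P) (≤-trans (≤-reflexive (sym y≡)) y≤b))
          (cong lam (sym (trans (cong (_% P) phase≡) ([m+kn]%n≡m%n m ℓ P)))))
    where
      m = y ∸ ℓ
      y≡ : y ≡ ℓ + m % P + (m / P) * P
      y≡ = trans (sym (m+[n∸m]≡n ℓ≤y)) (trans (cong (_+_ ℓ) (m≡m%n+[m/n]*n m P)) (sym (+-assoc ℓ (m % P) _)))
      identity : ∀ l m p₀ → l + m + p₀ * l ≡ m + l * suc p₀
      identity = solve-∀
      phase≡ : y + p₀ * ℓ ≡ m + ℓ * P
      phase≡ = trans (cong (λ z → z + p₀ * ℓ) (sym (m+[n∸m]≡n ℓ≤y))) (identity ℓ m p₀)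

  T≡lam∘phase : ∀ y → a ≤ y → y ≤ b → T y ≡ lam (phase y)
  T≡lam∘phase y a≤y y≤b with ℓ ≤? y
  ... | yes ℓ≤y = T≡lam∘phase-from-ℓ y ℓ≤y y≤b
  ... | no ℓ≰y =
    trans (repeats y a≤y y+P≤b)
    (trans (T≡lam∘phase-from-ℓ (y + P) (≤-trans (<⇒≤ ℓ<a+P) (+-monoˡ-≤ P a≤y)) y+P≤b)
           (cong lam (trans (cong (_% P) (identity y p₀ ℓ)) ([m+kn]%n≡m%n (y + p₀ * ℓ) 1 P))))
    where
      y+P≤b : y + P ≤ b
      y+P≤b = ≤-trans (<⇒≤ (+-monoˡ-< P (≰⇒> ℓ≰y))) ℓ+P≤b
      identity : ∀ y p₀ l → y + suc p₀ + p₀ * l ≡ y + p₀ * l + 1 * suc p₀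
      identity = solve-∀

  RotationInvariant : ℕ → Set
  RotationInvariant c = ∀ z → lam (z % P) ≡ lam ((z + c) % P)

  private
    phase-+ : ∀ i c → lam ((i + p₀ * ℓ + c) % P) ≡ lam (phase (i + c))
    phase-+ i c = cong (λ w → lam (w % P)) (identity i (p₀ * ℓ) c)
      where
        identity : ∀ i k c → i + k + c ≡ i + c + k
        identity = solve-∀

  T-offset : ∀ i t → a ≤ i → i + t ≤ b → T (i + t) ≡ lam ((i + p₀ * ℓ + t) % P)
  T-offset i t a≤i i+t≤b = trans (T≡lam∘phase (i + t) (≤-trans a≤i (m≤m+n i t)) i+t≤b) (sym (phase-+ i t))

  -- λ is primitive: a rotation symmetry of λ by c would make c a period of F.
  rotation-trivial : ∀ c → c < P → RotationInvariant c → c ≡ 0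
  rotation-trivial zero _ _ = refl
  rotation-trivial (suc c) c<P invariant =
    ⊥-elim (<⇒≱ c<P (proj₂ isPer (suc c) (s≤s z≤n , ≤len bound , repeats-c)))
    where
      bound : suc c + a ≤ suc b
      bound = ≤-trans (≤-reflexive (+-comm (suc c) a)) (≤-trans (+-monoʳ-≤ a (≤-trans (<⇒≤ c<P) (m≤m+n P P))) long)
      repeats-c : RepeatsWith T a b (suc c)
      repeats-c i a≤i i+c≤b =
        trans (T≡lam∘phase i a≤i (≤-trans (m≤m+n i (suc c)) i+c≤b))
        (trans (invariant (i + p₀ * ℓ))
        (trans (phase-+ i (suc c)) (sym (T≡lam∘phase (i + suc c) (≤-trans a≤i (m≤m+n i (suc c))) i+c≤b))))

  window-rotation-invariant : ∀ u v g → a ≤ u → v ≤ b → u + (P + g) ≤ suc v → RepeatsWith T u v g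
    → RotationInvariant g
  window-rotation-invariant u v g a≤u v≤b bound repeats-g z =
    trans (cong lam (sym t-offset))
    (trans (sym (T-offset u t a≤u (≤-trans (m≤m+n (u + t) g) u+t+g≤b)))
    (trans (repeats-g (u + t) (m≤m+n u t) u+t+g≤v)
    (trans (cong T (+-assoc u t g))
    (trans (T-offset u (t + g) a≤u (≤-trans (≤-reflexive (sym (+-assoc u t g))) u+t+g≤b))
           (cong lam (trans (cong (_% P) (sym (+-assoc (u + p₀ * ℓ) t g)))
                            (%-congˡ-+ {u + p₀ * ℓ + t} {z} g P t-offset)))))))
    where
      offset = ∃-offset-% (u + p₀ * ℓ) z P
      t = proj₁ offset
      t-offset = proj₂ (proj₂ offset)
      u+t+g≤v : u + t + g ≤ v
      u+t+g≤v = ≤-pred (≤-trans (≤-reflexive (cong suc (+-assoc u t g)))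
                (≤-trans (≤-reflexive (sym (+-suc u (t + g)))) (≤-trans (+-monoʳ-≤ u (+-monoˡ-≤ g (proj₁ (proj₂ offset)))) bound)))
      u+t+g≤b = ≤-trans u+t+g≤v v≤b

  window-per : ∀ u v → a ≤ u → v ≤ b → u + (P + P) ≤ suc v → IsPer T u v P
  window-per u v a≤u v≤b bound =
    (s≤s z≤n , ≤len (≤-trans (≤-reflexive (+-comm P u)) (≤-trans (+-monoʳ-≤ u (m≤m+n P P)) bound)) ,
     repeatsWith-restrict repeats a≤u v≤b) , minimal
    where
      minimal : ∀ r' → HasPeriod T u v r' → P ≤ r'
      minimal r' (1≤r' , _ , repeats-r') with P ≤? r'
      ... | yes P≤r' = P≤r'
      ... | no P≰r' = ⊥-elim (<⇒≱ 1≤r' (≤-reflexive (rotation-trivial r' r'<P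
              (window-rotation-invariant u v r' a≤u v≤b (≤-trans (+-monoʳ-≤ u (+-monoʳ-≤ P (<⇒≤ r'<P))) bound) repeats-r'))))
        where r'<P = ≰⇒> P≰r'

a'k≡a'-[kP+d] : ∀ a' P d k → a'k a' P d (+ k) ≡ + a' ℤ.- + (k * P + d)
a'k≡a'-[kP+d] a' P d k = begin
  + a' ℤ.- + k ℤ.* + P ℤ.- + d   ≡⟨ cong (λ m → + a' ℤ.- m ℤ.- + d) (ℤ.pos-* k P) ⟨
  + a' ℤ.- + (k * P) ℤ.- + d     ≡⟨ identity (+ a') (+ (k * P)) (+ d) ⟩
  + a' ℤ.- (+ (k * P) ℤ.+ + d)   ≡⟨ cong (λ m → + a' ℤ.- m) (ℤ.pos-+ (k * P) d) ⟨
  + a' ℤ.- + (k * P + d)         ∎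
  where
    open ≡-Reasoning
    identity : ∀ A M D → A ℤ.- M ℤ.- D ≡ A ℤ.- (M ℤ.+ D)
    identity = ℤ.solve-∀

a'k-fromℕ : ∀ a' P d k {x} → x + (k * P + d) ≡ a' → a'k a' P d (+ k) ≡ + x
a'k-fromℕ a' P d k {x} x+q≡a' = begin
  a'k a' P d (+ k)                          ≡⟨ a'k≡a'-[kP+d] a' P d k ⟩
  + a' ℤ.- + (k * P + d)                    ≡⟨ cong (λ m → + m ℤ.- + (k * P + d)) x+q≡a' ⟨
  + (x + (k * P + d)) ℤ.- + (k * P + d)     ≡⟨ cong (ℤ._- + (k * P + d)) (ℤ.pos-+ x (k * P + d)) ⟩
  + x ℤ.+ + (k * P + d) ℤ.- + (k * P + d)   ≡⟨ identity (+ x) (+ (k * P + d)) ⟩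
  + x                                       ∎
  where
    open ≡-Reasoning
    identity : ∀ X Q → X ℤ.+ Q ℤ.- Q ≡ X
    identity = ℤ.solve-∀

a'k-toℕ : ∀ a' P d k {x} → + x ≡ a'k a' P d (+ k) → x + (k * P + d) ≡ a'
a'k-toℕ a' P d k {x} x≡a'k = ℤ.+-injective (begin
  + (x + (k * P + d))                       ≡⟨ ℤ.pos-+ x (k * P + d) ⟩
  + x ℤ.+ + (k * P + d)                     ≡⟨ cong (ℤ._+ + (k * P + d)) (trans x≡a'k (a'k≡a'-[kP+d] a' P d k)) ⟩
  + a' ℤ.- + (k * P + d) ℤ.+ + (k * P + d)  ≡⟨ identity (+ a') (+ (k * P + d)) ⟩
  + a'                                      ∎)
  where
    open ≡-Reasoning
    identity : ∀ A Q → A ℤ.- Q ℤ.+ Q ≡ A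
    identity = ℤ.solve-∀

bk≡ : ∀ b P d k → bk b P d (+ k) ≡ + (b + (k * P + d))
bk≡ b P d k = begin
  + b ℤ.+ + k ℤ.* + P ℤ.+ + d    ≡⟨ cong (λ m → + b ℤ.+ m ℤ.+ + d) (ℤ.pos-* k P) ⟨
  + b ℤ.+ + (k * P) ℤ.+ + d      ≡⟨ cong (ℤ._+ + d) (ℤ.pos-+ b (k * P)) ⟨
  + (b + k * P) ℤ.+ + d          ≡⟨ ℤ.pos-+ (b + k * P) d ⟨
  + (b + k * P + d)              ≡⟨ cong +_ (+-assoc b (k * P) d) ⟩
  + (b + (k * P + d))            ∎
  where open ≡-Reasoning

above-ℕ-is-ℕ : ∀ {a} (z : ℤ) → + a ℤ.< z → Σ ℕ λ x → + x ≡ z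
above-ℕ-is-ℕ (+ x) _ = x , refl

delta≡ : ∀ {ℓ ℓ'} P .{{_ : NonZero P}} → ℓ ≤ ℓ' → delta ℓ ℓ' P ≡ (ℓ' ∸ ℓ) % P
delta≡ {ℓ} {ℓ'} P ℓ≤ℓ' = cong (ℤ._%ℕ P) (trans (ℤ.m-n≡m⊖n ℓ' ℓ) (ℤ.⊖-≥ ℓ≤ℓ'))

module Neighbours (n : ℕ) (T : ℕ → ℕ) (p₀ a b a' b' : ℕ) (lam : ℕ → ℕ) (ℓ ℓ' : ℕ)
  (F-run : IsRun n T a b (suc p₀)) (F'-run : IsRun n T a' b' (suc p₀))
  (lyndon : IsLyndonPos T a (suc p₀) lam ℓ) (lyndon' : IsLyndonPos T a' (suc p₀) lam ℓ')
  (a<a' : a < a') (a'≤b+1 : a' ≤ suc b) where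

  P : ℕ
  P = suc p₀

  long : a + (P + P) ≤ suc b
  long = len⇒square≤ (s≤s z≤n) (run-square F-run)

  long' : a' + (P + P) ≤ suc b'
  long' = len⇒square≤ (s≤s z≤n) (run-square F'-run)

  module F = Phase T p₀ a b lam ℓ (run-isPer F-run) long lyndon
  module F' = Phase T p₀ a' b' lam ℓ' (run-isPer F'-run) long' lyndon'

  repeats : RepeatsWith T a b P
  repeats = proj₂ (proj₂ (proj₁ (run-isPer F-run)))

  repeats' : RepeatsWith T a' b' P
  repeats' = proj₂ (proj₂ (proj₁ (run-isPer F'-run)))

  b'<n : b' < n
  b'<n = proj₂ (proj₁ F'-run)

  a'₀ : ℕ
  a'₀ = a' ∸ 1

  a'≡ : a' ≡ suc a'₀
  a'≡ = sym (suc-∸1 a<a')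

  left-break : T a'₀ ≢ T (a'₀ + P)
  left-break with run-left-maximal F'-run
  ... | inj₁ a'≡0 = λ _ → 0≢1+n (trans (sym a'≡0) a'≡)
  ... | inj₂ break = break

  a≤a'₀ : a ≤ a'₀
  a≤a'₀ = ≤-pred (≤-trans a<a' (≤-reflexive a'≡))

  a'₀≤b : a'₀ ≤ b
  a'₀≤b = ≤-pred (≤-trans (≤-reflexive (sym a'≡)) a'≤b+1)

  -- Otherwise F would repeat T[a'-1] = T[a'-1+p], so F' could be extended to the left.
  b+1≤a'+p₀ : suc b ≤ a' + p₀
  b+1≤a'+p₀ with suc b ≤? a' + p₀
  ... | yes le = le
  ... | no nle = ⊥-elim (left-break (repeats a'₀ a≤a'₀ (≤-pred (≤-trans (≤-reflexive shift) (≰⇒> nle)))))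
    where
      shift : suc (a'₀ + P) ≡ suc (a' + p₀)
      shift = cong suc (trans (+-suc a'₀ p₀) (cong (_+ p₀) (sym a'≡)))

  a'+p₀≤b' : a' + p₀ ≤ b'
  a'+p₀≤b' = ≤-pred (≤-trans (≤-reflexive (sym (+-suc a' p₀))) (≤-trans (+-monoʳ-≤ a' (m≤m+n P P)) long'))

  b+1≤b' : suc b ≤ b'
  b+1≤b' = ≤-trans b+1≤a'+p₀ a'+p₀≤b'

  right-break : T (b ∸ p₀) ≢ T (suc b)
  right-break with run-right-maximal F-run
  ... | inj₁ b+1≡n = λ _ → <⇒≢ (≤-<-trans b+1≤b' b'<n) b+1≡n
  ... | inj₂ break = λ eq → break (sym eq)

  a+p₀≤b : a + p₀ ≤ b
  a+p₀≤b = ≤-pred (≤-trans (≤-reflexive (sym (+-suc a p₀))) (≤-trans (+-monoʳ-≤ a (m≤m+n P P)) long))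

  b∸p₀+P≡b+1 : b ∸ p₀ + P ≡ suc b
  b∸p₀+P≡b+1 = trans (+-suc (b ∸ p₀) p₀) (cong suc (m∸n+n≡m (≤-trans (m≤n+m p₀ a) a+p₀≤b)))

  a≤b∸p₀ : a ≤ b ∸ p₀
  a≤b∸p₀ = m+n≤o⇒m≤o∸n a a+p₀≤b

  ℓ≤ℓ' : ℓ ≤ ℓ'
  ℓ≤ℓ' = ≤-trans (<⇒≤ (proj₁ (proj₂ lyndon))) (≤-trans (<⇒≤ a+P<a') (proj₁ lyndon'))
    where
      identity : ∀ a p₀ → suc (a + suc p₀) + p₀ ≡ a + (suc p₀ + suc p₀)
      identity = solve-∀
      a+P<a' : a + P < a'
      a+P<a' = +-cancelʳ-≤ p₀ (suc (a + P)) a' (≤-trans (≤-reflexive (identity a p₀)) (≤-trans long b+1≤a'+p₀))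

  δ : ℕ
  δ = delta ℓ ℓ' P

  δ≡ : δ ≡ (ℓ' ∸ ℓ) % P
  δ≡ = delta≡ P ℓ≤ℓ'

  δ<P : δ < P
  δ<P = subst (_< P) (sym δ≡) (m%n<n (ℓ' ∸ ℓ) P)

  phase-shift : ∀ y → F.phase y ≡ F'.phase (y + δ)
  phase-shift y = sym (begin
    (y + δ + p₀ * ℓ') % P                                  ≡⟨ cong (λ z → (y + δ + p₀ * z) % P) ℓ'≡ ⟩
    (y + δ + p₀ * (ℓ + (δ + Q * P))) % P                   ≡⟨ cong (_% P) (identity y δ ℓ Q p₀) ⟩
    (y + p₀ * ℓ + (δ + p₀ * Q) * P) % P                    ≡⟨ [m+kn]%n≡m%n (y + p₀ * ℓ) (δ + p₀ * Q) P ⟩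
    (y + p₀ * ℓ) % P                                       ∎)
    where
      open ≡-Reasoning
      Q = (ℓ' ∸ ℓ) / P
      ℓ'≡ : ℓ' ≡ ℓ + (δ + Q * P)
      ℓ'≡ = trans (sym (m+[n∸m]≡n ℓ≤ℓ')) (cong (_+_ ℓ) (trans (m≡m%n+[m/n]*n (ℓ' ∸ ℓ) P) (cong (_+ Q * P) (sym δ≡))))
      identity : ∀ y d l q p₀ → y + d + p₀ * (l + (d + q * suc p₀)) ≡ y + p₀ * l + (d + p₀ * q) * suc p₀
      identity = solve-∀

  cross : ∀ i c → a ≤ i → i ≤ b → a' ≤ i + (c * P + δ) → i + (c * P + δ) ≤ b' → T i ≡ T (i + (c * P + δ))
  cross i c a≤i i≤b a'≤j j≤b' = begin
    T i                              ≡⟨ F.T≡lam∘phase i a≤i i≤b ⟩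
    lam (F.phase i)                  ≡⟨ cong lam (phase-shift i) ⟩
    lam (F'.phase (i + δ))           ≡⟨ cong lam ([m+kn]%n≡m%n (i + δ + p₀ * ℓ') c P) ⟨
    lam ((i + δ + p₀ * ℓ' + c * P) % P) ≡⟨ cong (λ z → lam (z % P)) (identity i c p₀ δ (p₀ * ℓ')) ⟩
    lam (F'.phase (i + (c * P + δ))) ≡⟨ F'.T≡lam∘phase (i + (c * P + δ)) a'≤j j≤b' ⟨
    T (i + (c * P + δ))              ∎
    where
      open ≡-Reasoning
      identity : ∀ i c p₀ d k → i + d + k + c * suc p₀ ≡ i + (c * suc p₀ + d) + k
      identity = solve-∀

  -- Agreement on a full period makes the phase difference c a rotation symmetry of λ, hence c = 0.
  phase-sync : ∀ i j → a ≤ i → i + P ≤ suc b → a' ≤ j → j + P ≤ suc b'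
    → (∀ t → t < P → T (i + t) ≡ T (j + t)) → F.phase i ≡ F'.phase j
  phase-sync i j a≤i i+P≤b+1 a'≤j j+P≤b'+1 agree = begin
    A % P       ≡⟨ cong (_% P) (+-identityʳ A) ⟨
    (A + 0) % P ≡⟨ cong (λ z → (A + z) % P) (sym c≡0) ⟩
    (A + c) % P ≡⟨ A+c≡B ⟩
    B % P       ∎
    where
      open ≡-Reasoning
      A = i + p₀ * ℓ
      B = j + p₀ * ℓ'
      shift = ∃-offset-% A B P
      c = proj₁ shift
      A+c≡B = proj₂ (proj₂ shift)
      lam-agree : ∀ t → t < P → lam ((A + t) % P) ≡ lam ((B + t) % P)
      lam-agree t t<P =
        trans (sym (F.T-offset i t a≤i (≤-pred (≤-trans (+-monoʳ-< i t<P) i+P≤b+1))))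
        (trans (agree t t<P) (F'.T-offset j t a'≤j (≤-pred (≤-trans (+-monoʳ-< j t<P) j+P≤b'+1))))
      invariant : F.RotationInvariant c
      invariant z = begin
        lam (z % P)             ≡⟨ cong lam (sym (proj₂ (proj₂ offset))) ⟩
        lam ((A + t) % P)       ≡⟨ lam-agree t (proj₁ (proj₂ offset)) ⟩
        lam ((B + t) % P)       ≡⟨ cong lam (%-congˡ-+ {A + c} {B} t P A+c≡B) ⟨
        lam ((A + c + t) % P)   ≡⟨ cong (λ w → lam (w % P)) (identity A c t) ⟩
        lam ((A + t + c) % P)   ≡⟨ cong lam (%-congˡ-+ {A + t} {z} c P (proj₂ (proj₂ offset))) ⟩
        lam ((z + c) % P)       ∎
        where
          offset = ∃-offset-% A z P
          t = proj₁ offset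
          identity : ∀ a c t → a + c + t ≡ a + t + c
          identity = solve-∀
      c≡0 : c ≡ 0
      c≡0 = F.rotation-trivial c (proj₁ (proj₂ shift)) invariant

  right-end-mismatch : ∀ k → suc b + (k * P + δ) ≤ b' → T (suc b) ≢ T (suc b + (k * P + δ))
  right-end-mismatch k bound eq = right-break (trans crossed (sym eq))
    where
      w = b ∸ p₀
      identity : ∀ w k p₀ d → w + (suc k * suc p₀ + d) ≡ w + suc p₀ + (k * suc p₀ + d)
      identity = solve-∀
      w+q+P≡ : w + (suc k * P + δ) ≡ suc b + (k * P + δ)
      w+q+P≡ = trans (identity w k p₀ δ) (cong (_+ (k * P + δ)) b∸p₀+P≡b+1)
      crossed : T w ≡ T (suc b + (k * P + δ))
      crossed = trans (cross w (suc k) a≤b∸p₀ (m∸n≤m b p₀)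
                        (subst (a' ≤_) (sym w+q+P≡) (≤-trans a'≤b+1 (m≤m+n (suc b) _)))
                        (subst (_≤ b') (sym w+q+P≡) bound))
                      (cong T w+q+P≡)

  left-end-mismatch : ∀ k j → a ≤ j → j + (k * P + δ) ≡ a'₀ → T j ≢ T a'₀
  left-end-mismatch k j a≤j j+q≡a'₀ eq = left-break (trans (sym eq) crossed)
    where
      identity : ∀ j k p₀ d → j + (suc k * suc p₀ + d) ≡ j + (k * suc p₀ + d) + suc p₀
      identity = solve-∀
      j+q+P≡ : j + (suc k * P + δ) ≡ a'₀ + P
      j+q+P≡ = trans (identity j k p₀ δ) (cong (_+ P) j+q≡a'₀)
      a'₀+P≡a'+p₀ : a'₀ + P ≡ a' + p₀
      a'₀+P≡a'+p₀ = trans (+-suc a'₀ p₀) (cong (_+ p₀) (sym a'≡))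
      crossed : T j ≡ T (a'₀ + P)
      crossed = trans (cross j (suc k) a≤j (≤-trans (≤-trans (m≤m+n j _) (≤-reflexive j+q≡a'₀)) a'₀≤b)
                        (subst (a' ≤_) (sym (trans j+q+P≡ a'₀+P≡a'+p₀)) (m≤m+n a' p₀))
                        (subst (_≤ b') (sym (trans j+q+P≡ a'₀+P≡a'+p₀)) a'+p₀≤b'))
                      (cong T j+q+P≡)

  δ≢0 : δ ≢ 0
  δ≢0 δ≡0 = right-end-mismatch 0 (subst (_≤ b') (sym b+1+δ≡b+1) b+1≤b') (cong T (sym b+1+δ≡b+1))
    where
      b+1+δ≡b+1 : suc b + δ ≡ suc b
      b+1+δ≡b+1 = trans (cong (_+_ (suc b)) δ≡0) (+-identityʳ (suc b))

  private
    window-end : ∀ w → suc (w + P + p₀) ≡ w + (P + P)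
    window-end w = identity w p₀
      where
        identity : ∀ w p₀ → suc (w + suc p₀ + p₀) ≡ w + (suc p₀ + suc p₀)
        identity = solve-∀

  -- A fragment of length 4p lying in F ∪ F' contains a length-2p window lying in F or in F'.
  window-of-period-P : ∀ u v → a ≤ u → v ≤ b' → u + ((P + P) + (P + P)) ≤ suc v
    → Σ ℕ λ w → u ≤ w × w + (P + P) ≤ suc v × IsPer T w (w + P + p₀) P
  window-of-period-P u v a≤u v≤b' long-uv with u + (P + P) ≤? suc b
  ... | yes in-F =
    u , ≤-refl , ≤-trans (+-monoʳ-≤ u (m≤m+n (P + P) (P + P))) long-uv ,
    F.window-per u (u + P + p₀) a≤u (≤-pred (≤-trans (≤-reflexive (window-end u)) in-F)) (≤-reflexive (sym (window-end u)))
  ... | no not-in-F =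
    w , m≤m+n u (P + P) , w+2P≤v+1 ,
    F'.window-per w (w + P + p₀) (≤-trans a'≤b+1 (<⇒≤ (≰⇒> not-in-F)))
      (≤-pred (≤-trans (≤-reflexive (window-end w)) (≤-trans w+2P≤v+1 (s≤s v≤b')))) (≤-reflexive (sym (window-end w)))
    where
      w = u + (P + P)
      w+2P≤v+1 : w + (P + P) ≤ suc v
      w+2P≤v+1 = ≤-trans (≤-reflexive (+-assoc u (P + P) (P + P))) long-uv

  no-short-period : ∀ u v s → a ≤ u → v ≤ b' → u + ((P + P) + (P + P)) ≤ suc v
    → RepeatsWith T u v s → 1 ≤ s → P ≤ s
  no-short-period u v s a≤u v≤b' long-uv repeats-s 1≤s with P ≤? s
  ... | yes P≤s = P≤s
  ... | no P≰s =
    minimal s (1≤s , ≤len s+w≤ , repeatsWith-restrict repeats-s u≤w (≤-pred (≤-trans (≤-reflexive (window-end w)) w+2P≤)))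
    where
      window = window-of-period-P u v a≤u v≤b' long-uv
      w = proj₁ window
      u≤w = proj₁ (proj₂ window)
      w+2P≤ = proj₁ (proj₂ (proj₂ window))
      minimal = proj₂ (proj₂ (proj₂ (proj₂ window)))
      s+w≤ : s + w ≤ suc (w + P + p₀)
      s+w≤ = ≤-trans (≤-reflexive (+-comm s w))
               (≤-trans (+-monoʳ-≤ w (≤-trans (<⇒≤ (≰⇒> P≰s)) (m≤m+n P P))) (≤-reflexive (sym (window-end w))))

  module Candidate (k x : ℕ) (4≤k : 4 ≤ k) (x+q≡a' : x + (k * P + δ) ≡ a') (a<x : a < x)
    (y<b' : b + (k * P + δ) < b') where

    q : ℕ
    q = k * P + δ

    y : ℕ
    y = b + q

    4P≤q : 4 * P ≤ q
    4P≤q = ≤-trans (*-monoˡ-≤ P 4≤k) (m≤m+n (k * P) δ)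

    2P≤q : P + P ≤ q
    2P≤q = ≤-trans (m≤m+n (P + P) (P + P)) (≤-trans (≤-reflexive (sym (4*≡ P))) 4P≤q)

    P≤q : P ≤ q
    P≤q = ≤-trans (m≤m+n P P) 2P≤q

    1≤q : 1 ≤ q
    1≤q = ≤-trans (s≤s z≤n) P≤q

    x+q≤b+1 : x + q ≤ suc b
    x+q≤b+1 = subst (_≤ suc b) (sym x+q≡a') a'≤b+1

    x≤b : x ≤ b
    x≤b = ≤-pred (≤-trans (≤-reflexive (+-comm 1 x)) (≤-trans (+-monoʳ-≤ x 1≤q) x+q≤b+1))

    x+2q≤y+1 : x + (q + q) ≤ suc y
    x+2q≤y+1 = ≤-trans (≤-reflexive (sym (+-assoc x q q))) (+-monoˡ-≤ q x+q≤b+1)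

    repeats-q : RepeatsWith T x y q
    repeats-q i x≤i i+q≤y = cross i k (≤-trans (<⇒≤ a<x) x≤i) (+-cancelʳ-≤ q i b i+q≤y)
      (subst (_≤ i + q) x+q≡a' (+-monoˡ-≤ q x≤i)) (≤-trans i+q≤y (<⇒≤ y<b'))

    -- A shorter period would yield a common divisor g of both, and then p ∣ g on F, forcing p ∣ δ.
    per-q : ∀ z → x + (q + q) ≤ suc z → z ≤ y → IsPer T x z q
    per-q z long-z z≤y =
      (1≤q , ≤len (≤-trans (≤-reflexive (+-comm q x)) (≤-trans (+-monoʳ-≤ x (m≤m+n q q)) long-z)) ,
       repeatsWith-restrict repeats-q ≤-refl z≤y) , minimal
      where
        b≤z : b ≤ z
        b≤z = ≤-pred (begin
          suc b        ≤⟨ b+1≤a'+p₀ ⟩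
          a' + p₀      ≤⟨ +-monoʳ-≤ a' (≤-trans (n≤1+n p₀) P≤q) ⟩
          a' + q       ≡⟨ cong (_+ q) x+q≡a' ⟨
          x + q + q    ≡⟨ +-assoc x q q ⟩
          x + (q + q)  ≤⟨ long-z ⟩
          suc z        ∎)
          where open ≤-Reasoning
        minimal : ∀ r' → HasPeriod T x z r' → q ≤ r'
        minimal r' (1≤r' , _ , repeats-r') with q ≤? r'
        ... | yes q≤r' = q≤r'
        ... | no q≰r' = ⊥-elim (δ≢0 (trans (sym (m<n⇒m%n≡m δ<P)) (n∣m⇒m%n≡0 δ P P∣δ)))
          where
            r'<q = ≰⇒> q≰r'
            divisor = common-divisor-period r' q 1≤r' 1≤q repeats-r' (repeatsWith-restrict repeats-q ≤-refl z≤y)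
                        (≤-trans (+-monoʳ-≤ x (+-monoˡ-≤ q (<⇒≤ r'<q))) long-z)
            g = proj₁ divisor
            1≤g = proj₁ (proj₂ divisor)
            g∣q = proj₁ (proj₂ (proj₂ (proj₂ divisor)))
            repeats-g = proj₂ (proj₂ (proj₂ (proj₂ divisor)))
            g<q = ≤-<-trans (divisor≤ 1≤r' (proj₁ (proj₂ (proj₂ divisor)))) r'<q
            P+g≤q : P + g ≤ q
            P+g≤q = m+m≤n+n⇒m≤n (≤-trans (≤-reflexive (+-interchange P g)) (+-mono-≤ 2P≤q (proper-divisor-half g∣q g<q)))
            P∣g : P ∣ g
            P∣g = per∣period (F.window-per x b (<⇒≤ a<x) ≤-refl (≤-trans (+-monoʳ-≤ x 2P≤q) x+q≤b+1))
                    (repeatsWith-restrict repeats-g ≤-refl b≤z) 1≤g (≤-trans (+-monoʳ-≤ x P+g≤q) x+q≤b+1)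
            P∣δ : P ∣ δ
            P∣δ = ∣m+n∣m⇒∣n (∣-trans P∣g g∣q) (n∣m*n k)

    x₀ : ℕ
    x₀ = x ∸ 1

    x₀+q≡a'₀ : x₀ + q ≡ a'₀
    x₀+q≡a'₀ = suc-injective (trans (cong (_+ q) (suc-∸1 a<x)) (trans x+q≡a' a'≡))

    left-maximal : x ≡ 0 ⊎ T (x ∸ 1) ≢ T (x ∸ 1 + q)
    left-maximal = inj₂ λ eq →
      left-end-mismatch k x₀ (≤-pred (≤-trans a<x (≤-reflexive (sym (suc-∸1 a<x))))) x₀+q≡a'₀
        (trans eq (cong T x₀+q≡a'₀))

    right-maximal : suc y ≡ n ⊎ T (suc y) ≢ T (suc y ∸ q)
    right-maximal = inj₂ λ eq → right-end-mismatch k y<b' (sym (trans eq (cong T (m+n∸n≡m (suc b) q))))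

    is-run : IsRun n T x y q
    is-run = (≤-trans x≤b (m≤m+n b q) , <-trans y<b' b'<n) , per-q y x+2q≤y+1 ≤-refl ,
             square≤len {x} {y} {q} x+2q≤y+1 , left-maximal , right-maximal

    subper-lower-bound : ∀ i m s' → GenSquare T x y q i m → IsPer T i (i + m ∸ 1) s' → P ≤ s'
    subper-lower-bound i m s' (1≤m , x≤i , i+2m≤y+1 , halves-agree , per-square) ((1≤s' , _ , repeats-s') , _) =
      no-short-period i (i + m ∸ 1) s' (≤-trans (<⇒≤ a<x) x≤i)
        (≤-trans (∸-monoˡ-≤ 1 (≤-trans (+-monoʳ-≤ i (m≤m+n m (m + 0))) i+2m≤y+1)) (<⇒≤ y<b'))
        X-long repeats-s' 1≤s'
      where
        q≤m : q ≤ m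
        q≤m = proj₂ per-square m (1≤m , square-half≤len {i} 1≤m , square-repeats 1≤m halves-agree)
        X-long : i + ((P + P) + (P + P)) ≤ suc (i + m ∸ 1)
        X-long = ≤-trans (+-monoʳ-≤ i (≤-trans (≤-reflexive (sym (4*≡ P))) (≤-trans 4P≤q q≤m)))
                       (≤-reflexive (sym (suc-∸1 (≤-trans 1≤m (m≤n+m m i)))))

    is-subper : IsSubper T x y q P
    is-subper = (x , q , square , window) , subper-lower-bound
      where
        1≤x+2q : 1 ≤ x + 2 * q
        1≤x+2q = ≤-trans 1≤q (≤-trans (m≤m+n q (q + 0)) (m≤n+m _ x))
        x+2*q≤y+1 : x + 2 * q ≤ suc y
        x+2*q≤y+1 = ≤-trans (≤-reflexive (cong (_+_ x) (2*≡+ q))) x+2q≤y+1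
        halves-agree : ∀ j → j < q → T (x + j) ≡ T (x + q + j)
        halves-agree j j<q =
          trans (repeats-q (x + j) (m≤m+n x j) (≤-pred (begin
                   suc (x + j + q)  ≡⟨ cong (_+ q) (+-suc x j) ⟨
                   x + suc j + q    ≤⟨ +-monoˡ-≤ q (+-monoʳ-≤ x j<q) ⟩
                   x + q + q        ≡⟨ +-assoc x q q ⟩
                   x + (q + q)      ≤⟨ x+2q≤y+1 ⟩
                   suc y            ∎)))
                (cong T (+-swapʳ x j q))
          where open ≤-Reasoning
        square : GenSquare T x y q x q
        square = 1≤q , ≤-refl , x+2*q≤y+1 , halves-agree ,
                 per-q (x + 2 * q ∸ 1) (≤-trans (≤-reflexive (cong (_+_ x) (sym (2*≡+ q)))) (≤-reflexive (sym (suc-∸1 1≤x+2q))))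
                       (∸-monoˡ-≤ 1 x+2*q≤y+1)
        window : IsPer T x (x + q ∸ 1) P
        window = F.window-per x (x + q ∸ 1) (<⇒≤ a<x) (∸-monoˡ-≤ 1 x+q≤b+1)
                   (≤-trans (+-monoʳ-≤ x 2P≤q) (≤-reflexive (sym (suc-∸1 (≤-trans 1≤q (m≤n+m q x))))))

    in-pyramid : InPyramid n T P (a ⊓ a') (b ⊔ b') x y
    in-pyramid = q , is-run , is-subper , 4P≤q ,
      subst₂ (Periodic T) (sym x⊔≡x) (sym y⊓≡y) (q , per-y , square≤len {x} {y} {q} x+2q≤y+1) ,
      subst₂ (λ u v → IsPer T u v q) (sym x⊔≡x) (sym y⊓≡y) per-y
      where
        per-y = per-q y x+2q≤y+1 ≤-refl
        x⊔≡x : x ⊔ (a ⊓ a') ≡ x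
        x⊔≡x = trans (cong (x ⊔_) (m≤n⇒m⊓n≡m (<⇒≤ a<a'))) (m≥n⇒m⊔n≡m (<⇒≤ a<x))
        y⊓≡y : y ⊓ (b ⊔ b') ≡ y
        y⊓≡y = trans (cong (y ⊓_) (m≤n⇒m⊔n≡n (<⇒≤ b+1≤b'))) (m≤n⇒m⊓n≡m (<⇒≤ y<b'))

  module Necessity (x y r : ℕ) (R : IsRun n T x y r) (4P≤r : 4 * P ≤ r) (a<x : a < x) (y<b' : y < b') where

    1≤r : 1 ≤ r
    1≤r = proj₁ (proj₁ (run-isPer R))

    repeats-r : RepeatsWith T x y r
    repeats-r = proj₂ (proj₂ (proj₁ (run-isPer R)))

    x+2r≤y+1 : x + (r + r) ≤ suc y
    x+2r≤y+1 = len⇒square≤ {x} {y} 1≤r (run-square R)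

    2P≤r : P + P ≤ r
    2P≤r = ≤-trans (m≤m+n (P + P) (P + P)) (≤-trans (≤-reflexive (sym (4*≡ P))) 4P≤r)

    P≤r : P ≤ r
    P≤r = ≤-trans (m≤m+n P P) 2P≤r

    P<r : P < r
    P<r = ≤-trans (≤-reflexive (+-comm 1 P)) (≤-trans (+-monoʳ-≤ P (s≤s (z≤n {p₀}))) 2P≤r)

    p₀+P≤r : p₀ + P ≤ r
    p₀+P≤r = ≤-trans (+-monoˡ-≤ P (n≤1+n p₀)) 2P≤r

    x+2P≤y+1 : x + (P + P) ≤ suc y
    x+2P≤y+1 = ≤-trans (+-monoʳ-≤ x (≤-trans 2P≤r (m≤m+n r r))) x+2r≤y+1

    x+r≤y : x + r ≤ y
    x+r≤y = ≤-pred (≤-trans (≤-reflexive (sym (+-suc x r))) (≤-trans (+-monoʳ-≤ x (+-monoˡ-≤ r 1≤r)) x+2r≤y+1))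

    -- Otherwise a long window of R lies in F' (resp. F), making p a period of R.
    x<a' : x < a'
    x<a' with x <? a'
    ... | yes x<a' = x<a'
    ... | no x≮a' = ⊥-elim (<⇒≱ P<r (proj₂ (run-isPer R) P (proj₁ (F'.window-per x y (≮⇒≥ x≮a') (<⇒≤ y<b') x+2P≤y+1))))

    b<y : b < y
    b<y with b <? y
    ... | yes b<y = b<y
    ... | no b≮y = ⊥-elim (<⇒≱ P<r (proj₂ (run-isPer R) P (proj₁ (F.window-per x y (<⇒≤ a<x) (≮⇒≥ b≮y) x+2P≤y+1))))

    r-multiple-of-P : ∀ u v → IsPer T u v P → x ≤ u → v ≤ y → u + (P + r) ≤ suc v → Σ ℕ λ c → r ≡ P + c * P
    r-multiple-of-P u v per-P x≤u v≤y long-uv with per∣period per-P (repeatsWith-restrict repeats-r x≤u v≤y) 1≤r long-uv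
    ... | divides zero r≡0 = ⊥-elim (<⇒≱ 1≤r (≤-reflexive r≡0))
    ... | divides (suc c) r≡ = c , r≡

    -- Otherwise R ∩ F' is long, so p ∣ r and R carries the mismatch T[a'-1] ≠ T[a'-1+p] back onto itself.
    x+P≤b+1 : x + P ≤ suc b
    x+P≤b+1 with x + P ≤? suc b
    ... | yes x+P≤b+1 = x+P≤b+1
    ... | no x+P≰b+1 = ⊥-elim (left-break (begin
      T a'₀                  ≡⟨ repeats-r a'₀ x≤a'₀ a'₀+r≤y ⟩
      T (a'₀ + r)            ≡⟨ cong T a'₀+r≡ ⟩
      T (a'₀ + P + c * P)    ≡⟨ repeatsWith-* repeats' c (a'₀ + P) a'≤a'₀+P
                                  (≤-trans (≤-reflexive (sym a'₀+r≡)) (≤-trans a'₀+r≤y (<⇒≤ y<b'))) ⟨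
      T (a'₀ + P)            ∎))
      where
        open ≡-Reasoning
        a'≤x+p₀ : a' ≤ x + p₀
        a'≤x+p₀ = ≤-trans a'≤b+1 (≤-pred (≤-trans (≰⇒> x+P≰b+1) (≤-reflexive (+-suc x p₀))))
        identity : ∀ x p₀ P r → x + p₀ + (P + r) ≡ x + (p₀ + P + r)
        identity = solve-∀
        a'+P+r≤y+1 : a' + (P + r) ≤ suc y
        a'+P+r≤y+1 = ≤-trans (+-monoˡ-≤ (P + r) a'≤x+p₀) (≤-trans (≤-reflexive (identity x p₀ P r))
                       (≤-trans (+-monoʳ-≤ x (+-monoˡ-≤ r p₀+P≤r)) x+2r≤y+1))
        multiple = r-multiple-of-P a' y
                     (F'.window-per a' y ≤-refl (<⇒≤ y<b') (≤-trans (+-monoʳ-≤ a' (+-monoʳ-≤ P P≤r)) a'+P+r≤y+1))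
                     (<⇒≤ x<a') ≤-refl a'+P+r≤y+1
        c = proj₁ multiple
        a'₀+r≡ : a'₀ + r ≡ a'₀ + P + c * P
        a'₀+r≡ = trans (cong (_+_ a'₀) (proj₂ multiple)) (sym (+-assoc a'₀ P (c * P)))
        x≤a'₀ : x ≤ a'₀
        x≤a'₀ = ≤-pred (≤-trans x<a' (≤-reflexive a'≡))
        a'₀+r≤y : a'₀ + r ≤ y
        a'₀+r≤y = ≤-pred (≤-trans (≤-reflexive (cong (_+ r) (sym a'≡))) (≤-trans (+-monoʳ-≤ a' (m≤n+m r P)) a'+P+r≤y+1))
        a'≤a'₀+P : a' ≤ a'₀ + P
        a'≤a'₀+P = ≤-trans (≤-reflexive a'≡) (≤-trans (s≤s (m≤m+n a'₀ p₀)) (≤-reflexive (sym (+-suc a'₀ p₀))))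

    -- Symmetrically, with R ∩ F and the mismatch T[b+1-p] ≠ T[b+1].
    a'+P≤y+1 : a' + P ≤ suc y
    a'+P≤y+1 with a' + P ≤? suc y
    ... | yes a'+P≤y+1 = a'+P≤y+1
    ... | no a'+P≰y+1 = ⊥-elim (right-break (begin
      T (b ∸ p₀)       ≡⟨ cong T z+cP≡ ⟨
      T (z + c * P)    ≡⟨ repeatsWith-* repeats c z (≤-trans (<⇒≤ a<x) x≤z) (≤-trans (≤-reflexive z+cP≡) (m∸n≤m b p₀)) ⟨
      T z              ≡⟨ repeats-r z x≤z (≤-trans (≤-reflexive z+r≡b+1) b<y) ⟩
      T (z + r)        ≡⟨ cong T z+r≡b+1 ⟩
      T (suc b)        ∎))
      where
        open ≡-Reasoning
        y+1≤b+1+p₀ : suc y ≤ suc b + p₀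
        y+1≤b+1+p₀ = ≤-trans (≤-pred (≤-trans (≰⇒> a'+P≰y+1) (≤-reflexive (+-suc a' p₀)))) (+-monoˡ-≤ p₀ a'≤b+1)
        identity : ∀ x P r p₀ → x + (P + r) + p₀ ≡ x + (p₀ + P + r)
        identity = solve-∀
        x+P+r≤b+1 : x + (P + r) ≤ suc b
        x+P+r≤b+1 = +-cancelʳ-≤ p₀ (x + (P + r)) (suc b) (≤-trans (≤-reflexive (identity x P r p₀))
                      (≤-trans (+-monoʳ-≤ x (+-monoˡ-≤ r p₀+P≤r)) (≤-trans x+2r≤y+1 y+1≤b+1+p₀)))
        multiple = r-multiple-of-P x b
                     (F.window-per x b (<⇒≤ a<x) ≤-refl (≤-trans (+-monoʳ-≤ x (+-monoʳ-≤ P P≤r)) x+P+r≤b+1))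
                     ≤-refl (<⇒≤ b<y) x+P+r≤b+1
        c = proj₁ multiple
        x+r≤b+1 : x + r ≤ suc b
        x+r≤b+1 = ≤-trans (+-monoʳ-≤ x (m≤n+m r P)) x+P+r≤b+1
        z = suc b ∸ r
        z+r≡b+1 : z + r ≡ suc b
        z+r≡b+1 = m∸n+n≡m (≤-trans (m≤n+m r x) x+r≤b+1)
        x≤z : x ≤ z
        x≤z = m+n≤o⇒m≤o∸n x x+r≤b+1
        z+cP≡ : z + c * P ≡ b ∸ p₀
        z+cP≡ = +-cancelʳ-≡ P (z + c * P) (b ∸ p₀) (begin
          z + c * P + P   ≡⟨ +-assoc z (c * P) P ⟩
          z + (c * P + P) ≡⟨ cong (_+_ z) (trans (+-comm (c * P) P) (sym (proj₂ multiple))) ⟩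
          z + r           ≡⟨ z+r≡b+1 ⟩
          suc b           ≡⟨ b∸p₀+P≡b+1 ⟨
          b ∸ p₀ + P      ∎)

    synced-block : Σ ℕ λ i → a ≤ i × i + P ≤ suc b × x ≤ i × a' ≤ i + r × i + r + P ≤ suc y
    synced-block with a' ≤? x + r
    ... | yes a'≤x+r = x , <⇒≤ a<x , x+P≤b+1 , ≤-refl , a'≤x+r ,
          ≤-trans (≤-reflexive (+-assoc x r P)) (≤-trans (+-monoʳ-≤ x (+-monoʳ-≤ r P≤r)) x+2r≤y+1)
    ... | no a'≰x+r = a' ∸ r , ≤-trans (<⇒≤ a<x) x≤i ,
          ≤-trans (+-monoʳ-≤ (a' ∸ r) P≤r) (≤-trans (≤-reflexive i+r≡a') a'≤b+1) , x≤i ,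
          ≤-reflexive (sym i+r≡a') , ≤-trans (≤-reflexive (cong (_+ P) i+r≡a')) a'+P≤y+1
      where
        x+r≤a' = <⇒≤ (≰⇒> a'≰x+r)
        x≤i = m+n≤o⇒m≤o∸n x x+r≤a'
        i+r≡a' : a' ∸ r + r ≡ a'
        i+r≡a' = m∸n+n≡m (≤-trans (m≤n+m r x) x+r≤a')

    i : ℕ
    i = proj₁ synced-block

    x≤i : x ≤ i
    x≤i = proj₁ (proj₂ (proj₂ (proj₂ synced-block)))

    i+r+P≤y+1 : i + r + P ≤ suc y
    i+r+P≤y+1 = proj₂ (proj₂ (proj₂ (proj₂ (proj₂ synced-block))))

    block-agree : ∀ t → t < P → T (i + t) ≡ T (i + r + t)
    block-agree t t<P = trans (repeats-r (i + t) (≤-trans x≤i (m≤m+n i t)) (≤-pred (begin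
      suc (i + t + r)   ≡⟨ cong (_+ r) (+-suc i t) ⟨
      i + suc t + r     ≤⟨ +-monoˡ-≤ r (+-monoʳ-≤ i t<P) ⟩
      i + P + r         ≡⟨ +-swapʳ i P r ⟩
      i + r + P         ≤⟨ i+r+P≤y+1 ⟩
      suc y             ∎))) (cong T (+-swapʳ i t r))
      where open ≤-Reasoning

    -- Both F.phase i and F'.phase (i + r) agree with the phase of i shifted by δ, so r ≡ δ (mod p).
    r%P≡δ : r % P ≡ δ
    r%P≡δ = begin
      r % P                  ≡⟨ +-cancelˡ-% (i + p₀ * ℓ') r δ P (begin
                                   (i + p₀ * ℓ' + r) % P  ≡⟨ cong (_% P) (+-swapʳ i (p₀ * ℓ') r) ⟩
                                   F'.phase (i + r)       ≡⟨ synced ⟨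
                                   F.phase i              ≡⟨ phase-shift i ⟩
                                   F'.phase (i + δ)       ≡⟨ cong (_% P) (+-swapʳ i δ (p₀ * ℓ')) ⟩
                                   (i + p₀ * ℓ' + δ) % P  ∎) ⟩
      δ % P                  ≡⟨ m<n⇒m%n≡m δ<P ⟩
      δ                      ∎
      where
        open ≡-Reasoning
        synced : F.phase i ≡ F'.phase (i + r)
        synced = phase-sync i (i + r) (proj₁ (proj₂ synced-block)) (proj₁ (proj₂ (proj₂ synced-block)))
                   (proj₁ (proj₂ (proj₂ (proj₂ (proj₂ synced-block))))) (≤-trans i+r+P≤y+1 (≤-trans y<b' (n≤1+n b'))) block-agree

    k : ℕ
    k = r / P

    r≡kP+δ : r ≡ k * P + δ
    r≡kP+δ = trans (m≡m%n+[m/n]*n r P) (trans (cong (_+ k * P) r%P≡δ) (+-comm δ (k * P)))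

    4≤k : 4 ≤ k
    4≤k with 4 ≤? k
    ... | yes 4≤k = 4≤k
    ... | no 4≰k = ⊥-elim (<⇒≱ r<4P 4P≤r)
      where
        open ≤-Reasoning
        identity : ∀ P → 3 * P + P ≡ 4 * P
        identity = solve-∀
        r<4P : r < 4 * P
        r<4P = begin-strict
          r           ≡⟨ r≡kP+δ ⟩
          k * P + δ   <⟨ +-monoʳ-< (k * P) δ<P ⟩
          k * P + P   ≤⟨ +-monoˡ-≤ P (*-monoˡ-≤ P (≤-pred (≰⇒> 4≰k))) ⟩
          3 * P + P   ≡⟨ identity P ⟩
          4 * P       ∎

    x≤b : x ≤ b
    x≤b = ≤-pred (≤-trans (≤-trans (≤-reflexive (+-comm 1 x)) (+-monoʳ-≤ x (s≤s (z≤n {p₀})))) x+P≤b+1)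

    -- Otherwise T[x-1] = T[x-1+r] by crossing from F to F', and R would extend to the left.
    x+r≤a' : x + r ≤ a'
    x+r≤a' with x + r ≤? a' | run-left-maximal R
    ... | yes x+r≤a' | _ = x+r≤a'
    ... | no _ | inj₁ x≡0 = ⊥-elim (<⇒≱ a<x (≤-trans (≤-reflexive x≡0) z≤n))
    ... | no x+r≰a' | inj₂ left-break-R = ⊥-elim (left-break-R (trans crossed (cong (λ s → T (x₀ + s)) (sym r≡kP+δ))))
      where
        x₀ = x ∸ 1
        x₀+1≡x : suc x₀ ≡ x
        x₀+1≡x = suc-∸1 a<x
        crossed : T x₀ ≡ T (x₀ + (k * P + δ))
        crossed = cross x₀ k (≤-pred (≤-trans a<x (≤-reflexive (sym x₀+1≡x)))) (≤-trans (m∸n≤m x 1) x≤b)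
          (subst (λ s → a' ≤ x₀ + s) r≡kP+δ (≤-pred (≤-trans (≰⇒> x+r≰a') (≤-reflexive (cong (_+ r) (sym x₀+1≡x))))))
          (subst (λ s → x₀ + s ≤ b') r≡kP+δ (≤-trans (+-monoˡ-≤ r (m∸n≤m x 1)) (≤-trans x+r≤y (<⇒≤ y<b'))))

    -- Otherwise R carries T[a'-1-r] onto T[a'-1], contradicting the left end of F'.
    a'≤x+r : a' ≤ x + r
    a'≤x+r with a' ≤? x + r
    ... | yes a'≤x+r = a'≤x+r
    ... | no a'≰x+r = ⊥-elim (left-end-mismatch k w (≤-trans (<⇒≤ a<x) x≤w)
                        (trans (cong (_+_ w) (sym r≡kP+δ)) w+r≡a'₀)
                        (trans (repeats-r w x≤w (≤-trans (≤-reflexive w+r≡a'₀) (≤-trans a'₀≤b (<⇒≤ b<y)))) (cong T w+r≡a'₀)))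
      where
        x+r≤a'₀ : x + r ≤ a'₀
        x+r≤a'₀ = ≤-pred (≤-trans (≰⇒> a'≰x+r) (≤-reflexive a'≡))
        w = a'₀ ∸ r
        w+r≡a'₀ : w + r ≡ a'₀
        w+r≡a'₀ = m∸n+n≡m (≤-trans (m≤n+m r x) x+r≤a'₀)
        x≤w : x ≤ w
        x≤w = m+n≤o⇒m≤o∸n x x+r≤a'₀

    -- Otherwise R carries T[b+1] onto T[b+1+r], contradicting the right end of F.
    y≤b+r : y ≤ b + r
    y≤b+r with y ≤? b + r
    ... | yes y≤b+r = y≤b+r
    ... | no y≰b+r = ⊥-elim (right-end-mismatch k (subst (λ s → suc b + s ≤ b') r≡kP+δ (≤-trans (≰⇒> y≰b+r) (<⇒≤ y<b')))
                        (trans (repeats-r (suc b) (≤-trans x≤b (n≤1+n b)) (≰⇒> y≰b+r)) (cong (λ s → T (suc b + s)) r≡kP+δ)))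

    -- Otherwise T[y+1-r] = T[y+1] by crossing from F to F', and R would extend to the right.
    b+r≤y : b + r ≤ y
    b+r≤y with b + r ≤? y | run-right-maximal R
    ... | yes b+r≤y | _ = b+r≤y
    ... | no _ | inj₁ y+1≡n = ⊥-elim (<⇒≢ (≤-<-trans y<b' b'<n) y+1≡n)
    ... | no b+r≰y | inj₂ right-break-R = ⊥-elim (right-break-R (sym (trans crossed (cong T w+q≡y+1))))
      where
        x+r≤y+1 = ≤-trans x+r≤y (n≤1+n y)
        w = suc y ∸ r
        w+r≡y+1 : w + r ≡ suc y
        w+r≡y+1 = m∸n+n≡m (≤-trans (m≤n+m r x) x+r≤y+1)
        w+q≡y+1 : w + (k * P + δ) ≡ suc y
        w+q≡y+1 = trans (cong (_+_ w) (sym r≡kP+δ)) w+r≡y+1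
        crossed : T w ≡ T (w + (k * P + δ))
        crossed = cross w k (≤-trans (<⇒≤ a<x) (m+n≤o⇒m≤o∸n x x+r≤y+1))
          (+-cancelʳ-≤ r w b (≤-trans (≤-reflexive w+r≡y+1) (≰⇒> b+r≰y)))
          (subst (a' ≤_) (sym w+q≡y+1) (≤-trans a'≤b+1 (<⇒≤ (s≤s b<y))))
          (subst (_≤ b') (sym w+q≡y+1) y<b')

    is-candidate : Σ ℕ λ k → 4 ≤ k × x + (k * P + δ) ≡ a' × y ≡ b + (k * P + δ)
    is-candidate = k , 4≤k , trans (cong (_+_ x) (sym r≡kP+δ)) (≤-antisym x+r≤a' a'≤x+r) ,
            trans (≤-antisym y≤b+r b+r≤y) (cong (_+_ b) r≡kP+δ)

  pyramid⇔candidate : ∀ x y →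
    (InPyramid n T P (a ⊓ a') (b ⊔ b') x y × a < x × x < b' × a < y × y < b')
    ⇔ (Σ ℤ λ k → (+ 4 ℤ.≤ k × + a ℤ.< a'k a' P δ k × bk b P δ k ℤ.< + b')
                 × + x ≡ a'k a' P δ k × + y ≡ bk b P δ k)
  pyramid⇔candidate x y = mk⇔ to from
    where
      to : InPyramid n T P (a ⊓ a') (b ⊔ b') x y × a < x × x < b' × a < y × y < b'
        → Σ ℤ λ k → (+ 4 ℤ.≤ k × + a ℤ.< a'k a' P δ k × bk b P δ k ℤ.< + b')
                    × + x ≡ a'k a' P δ k × + y ≡ bk b P δ k
      to ((r , run , _ , 4P≤r , _) , a<x , _ , _ , y<b') with Necessity.is-candidate x y r run 4P≤r a<x y<b'
      ... | k , 4≤k , x+q≡a' , y≡b+q =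
        + k , (+≤+ 4≤k , subst (λ z → + a ℤ.< z) (sym a'k≡x) (+<+ a<x) , subst (λ z → z ℤ.< + b') (sym bk≡y) (+<+ y<b')) ,
        sym a'k≡x , sym bk≡y
        where
          a'k≡x = a'k-fromℕ a' P δ k x+q≡a'
          bk≡y = trans (bk≡ b P δ k) (cong +_ (sym y≡b+q))
      from : (Σ ℤ λ k → (+ 4 ℤ.≤ k × + a ℤ.< a'k a' P δ k × bk b P δ k ℤ.< + b')
                        × + x ≡ a'k a' P δ k × + y ≡ bk b P δ k)
        → InPyramid n T P (a ⊓ a') (b ⊔ b') x y × a < x × x < b' × a < y × y < b'
      from (-[1+ _ ] , (() , _) , _)
      from (+ k , (+≤+ 4≤k , a<a'k , bk<b') , x≡a'k , y≡bk) =
        subst (InPyramid n T P (a ⊓ a') (b ⊔ b') x) (sym y≡b+q) C.in-pyramid ,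
        a<x , ≤-<-trans C.x≤b b+1≤b' , ≤-trans a<x (≤-trans C.x≤b (≤-trans (m≤m+n b _) (≤-reflexive (sym y≡b+q)))) , y<b'
        where
          y≡b+q : y ≡ b + (k * P + δ)
          y≡b+q = ℤ.+-injective (trans y≡bk (bk≡ b P δ k))
          a<x : a < x
          a<x = ℤ.drop‿+<+ (subst (λ z → + a ℤ.< z) (sym x≡a'k) a<a'k)
          y<b' : y < b'
          y<b' = ℤ.drop‿+<+ (subst (λ z → z ℤ.< + b') (sym y≡bk) bk<b')
          module C = Candidate k x 4≤k (a'k-toℕ a' P δ k x≡a'k) a<x (subst (_< b') y≡b+q y<b')

  candidate-is-run : (k : ℤ) → + 4 ℤ.≤ k → + a ℤ.< a'k a' P δ k → bk b P δ k ℤ.< + b'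
    → Σ ℕ λ x → Σ ℕ λ y → Σ ℕ λ r → + x ≡ a'k a' P δ k × + y ≡ bk b P δ k
        × IsRun n T x y r × + r ≡ k ℤ.* + P ℤ.+ + δ
  candidate-is-run (+ k) (+≤+ 4≤k) a<a'k bk<b' with above-ℕ-is-ℕ _ a<a'k
  ... | x , x≡a'k =
    x , b + (k * P + δ) , k * P + δ , x≡a'k , sym (bk≡ b P δ k) , C.is-run ,
    trans (ℤ.pos-+ (k * P) δ) (cong (ℤ._+ + δ) (ℤ.pos-* k P))
    where
      module C = Candidate k x 4≤k (a'k-toℕ a' P δ k x≡a'k) (ℤ.drop‿+<+ (subst (λ z → + a ℤ.< z) (sym x≡a'k) a<a'k))
                   (ℤ.drop‿+<+ (subst (λ z → z ℤ.< + b') (bk≡ b P δ k) bk<b'))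

lemma17 : (n : ℕ) (T : ℕ → ℕ) (a b a' b' p : ℕ) .{{_ : NonZero p}}
    → IsRun n T a b p → IsRun n T a' b' p
    → (Σ ℕ λ i → a ∸ 1 ≤ i × i ≤ b + 1 × a' ≤ i × i ≤ b')
    → a < a'
    → (lam : ℕ → ℕ) → IsLyndonRoot T a p lam → IsLyndonRoot T a' p lam
    → (ℓ ℓ' : ℕ) → IsLyndonPos T a p lam ℓ → IsLyndonPos T a' p lam ℓ'
    → ((x y : ℕ) →
         (InPyramid n T p (a ⊓ a') (b ⊔ b') x y × a < x × x < b' × a < y × y < b')
         ⇔ (Σ ℤ λ k → (+ 4 ℤ.≤ k × + a ℤ.< a'k a' p (delta ℓ ℓ' p) k
                        × bk b p (delta ℓ ℓ' p) k ℤ.< + b')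
                      × + x ≡ a'k a' p (delta ℓ ℓ' p) k
                      × + y ≡ bk b p (delta ℓ ℓ' p) k))
      × ((k : ℤ) → + 4 ℤ.≤ k → + a ℤ.< a'k a' p (delta ℓ ℓ' p) k
           → bk b p (delta ℓ ℓ' p) k ℤ.< + b'
           → Σ ℕ λ x → Σ ℕ λ y → Σ ℕ λ r →
               + x ≡ a'k a' p (delta ℓ ℓ' p) k × + y ≡ bk b p (delta ℓ ℓ' p) k
               × IsRun n T x y r × + r ≡ k ℤ.* + p ℤ.+ + delta ℓ ℓ' p)
lemma17 n T a b a' b' zero (_ , ((() , _) , _) , _) _ _ _ _ _ _ _ _ _ _
lemma17 n T a b a' b' (suc p₀) F-run F'-run (_ , _ , i≤b+1 , a'≤i , _) a<a' lam _ _ ℓ ℓ' lyndon lyndon' =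
  N.pyramid⇔candidate , N.candidate-is-run
  where
    module N = Neighbours n T p₀ a b a' b' lam ℓ ℓ' F-run F'-run lyndon lyndon' a<a'
                 (≤-trans a'≤i (≤-trans i≤b+1 (≤-reflexive (+-comm b 1))))
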